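{- Let $c$ be a configuration of $K_n$ whose vertices are indexed $v_1,\dots,v_n$ so that $c(v_1)\ge c(v_2)\ge\dots\ge c(v_n)$, and suppose $c(v_1)=n-1$ and $c(v_i)\le n-2$ for all $i\ge 2$. If $c$ is not volatile, then the stable configuration corresponding to $c$ (obtained by firing vertices until no vertex can fire) has the same number of in-chips as $c$.
   Context: A configuration of a graph $G$ is a function $c: V(G)\to \mathbb{N}\cup\{0\}$. A vertex $v$ may be fired if it currently has at least $\deg(v)$ chips; firing $v$ removes $\deg(v)$ chips from $v$ and adds one chip to each neighbour. A configuration is volatile if there is an infinite sequence of vertices that may be fired in that order, and stable if no vertex can be fired; for a non-volatile configuration, every maximal sequence of firings ends in the same stable configuration. Number of in-chips: for a configuration $c$ of $K_n$, index the vertices as $v_1,\dots,v_n$ in nonincreasing order of chip count, and represent $c$ as a grid with $n$ columns in which cells $(i,1),\dots,(i,c(v_i))$ of column $i$ are filled. The critical triangle is the set of cells $(i,j)$ with $i,j\ge 1$ and $i+j\le n$; chips (filled cells) inside it are in-chips, and the number of in-chips equals $\sum_{i=1}^n \min\{c(v_i), n-i\}$. -}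

module Defs where

open import Data.Nat using (ℕ; zero; suc; _+_; _∸_; _≤_; _⊔_; _⊓_)
open import Data.Nat.Properties using (≤-decTotalOrder)
open import Data.Fin using (Fin; _≟_)
open import Data.List using (List; []; _∷_; zipWith; upTo)
open import Data.Nat.ListAction using (sum)
open import Data.Vec.Functional using (toList)
open import Data.Product using (Σ; _×_)
open import Data.Unit using (⊤)
open import Relation.Nullary using (¬_; yes; no)
open import Data.List.Sort.InsertionSort ≤-decTotalOrder using (sort)

Config : ℕ → Set
Config n = Fin n → ℕ

deg : ℕ → ℕ
deg n = n ∸ 1

CanFire : ∀ {n} → Config n → Fin n → Set
CanFire {n} c v = deg n ≤ c v

fire : ∀ {n} → Config n → Fin n → Config n
fire {n} c v w with v ≟ w
... | yes _ = c w ∸ deg n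
... | no  _ = suc (c w)

Stable : ∀ {n} → Config n → Set
Stable c = ∀ v → ¬ CanFire c v

run : ∀ {n} → Config n → (ℕ → Fin n) → ℕ → Config n
run c s zero    = c
run c s (suc k) = fire (run c s k) (s k)

Volatile : ∀ {n} → Config n → Set
Volatile {n} c = Σ (ℕ → Fin n) λ s → ∀ k → CanFire (run c s k) (s k)

runList : ∀ {n} → Config n → List (Fin n) → Config n
runList c []       = c
runList c (v ∷ vs) = runList (fire c v) vs

Legal : ∀ {n} → Config n → List (Fin n) → Set
Legal c []       = ⊤
Legal c (v ∷ vs) = CanFire c v × Legal (fire c v) vs

-- Number of in-chips: with the chip counts sorted nonincreasingly as
-- c(v_1) ≥ … ≥ c(v_n), it is Σ_i min(c(v_i), n - i).  Equivalently, sorting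
-- nondecreasingly as w_0 ≤ … ≤ w_{n-1} (w_j = c(v_{n-j})), it is Σ_j min(w_j, j).
inChips : ∀ {n} → Config n → ℕ
inChips {n} c = sum (zipWith (λ j w → w ⊓ j) (upTo n) (sort (toList c)))

-- Count in-chips by rows: row t of the grid holds N t = #{v : c v ≥ t} chips and
-- the critical triangle has n − t cells there, so there are Σₜ min (N t, n − t)
-- in-chips.  Firing v with c v ≥ n − 1 lifts the other n − 1 columns by one and
-- lowers v's by n − 1.  Row 1 becomes full, N' 1 ≥ n − 1; and row t + 1 inherits
-- row t minus v's chip, plus one if v's lowered column still reaches row t + 1.
-- Without the plus, min (N t, n − t) drops by exactly one, since the triangle row
-- t + 1 is one cell shorter; with it nothing is lost provided row t was full.  That
-- is the invariant "a column taller than (n − 1) + t forces N t ≥ n − t": it holds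
-- initially, as no column exceeds n − 1, and survives firing, which raises each
-- column by at most one.  The n − 1 units lost in rows 2, …, n are the n − 1 gained
-- in row 1.

module Submission where

open import Data.Empty using (⊥-elim)
open import Data.Fin using (Fin; zero; suc; toℕ; inject₁; fromℕ; _≟_)
  renaming (_≤_ to _≤ᶠ_)
open import Data.Fin.Properties using (toℕ<n; toℕ-inject₁; toℕ-fromℕ; punchInᵢ≢i)
open import Data.List using (List; []; _∷_; length; map; zipWith; applyUpTo; upTo)
open import Data.List.Properties using (length-tabulate)
open import Data.List.Relation.Binary.Permutation.Propositional using (_↭_)
open import Data.List.Relation.Binary.Permutation.Propositional.Properties
  using (map⁺; ↭-length)
open import Data.List.Relation.Unary.All using (All; []; _∷_)
open import Data.List.Relation.Unary.Linked using (Linked) renaming (tail to tailₗ)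
open import Data.List.Relation.Unary.Linked.Properties using (Linked⇒All)
open import Data.Nat using (ℕ; zero; suc; _+_; _∸_; _≤_; _<_; _⊓_; _≤?_; z≤n; s≤s; s≤s⁻¹; pred)
open import Data.Nat.Properties hiding (_≟_)
open import Data.Nat.ListAction as List using ()
open import Data.Nat.ListAction.Properties using (sum-↭)
open import Data.List.Sort.InsertionSort ≤-decTotalOrder using (sort)
open import Data.List.Sort.InsertionSort.Properties ≤-decTotalOrder using (sort-↭; sort-↗)
open import Data.Product using (_,_)
open import Data.Vec.Functional using (toList; removeAt)
open import Function using (_∘_; id)
open import Relation.Binary.PropositionalEquality
open import Relation.Nullary using (¬_; Dec; yes; no)
open import Algebra.Properties.CommutativeMonoid.Sum +-0-commutativeMonoid
  using (sum; sum-syntax; sum-remove; ∑-distrib-+; sum-cong-≗; sum-init-last; sum-replicate-zero)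
open import Algebra.Properties.CommutativeSemigroup +-commutativeSemigroup
  using (x∙yz≈y∙xz; xy∙z≈zy∙x)

open import Defs

𝟙[_≤_] : ℕ → ℕ → ℕ
𝟙[ zero  ≤ x     ] = 1
𝟙[ suc t ≤ zero  ] = 0
𝟙[ suc t ≤ suc x ] = 𝟙[ t ≤ x ]

𝟙[≤]≡1 : ∀ {t x} → t ≤ x → 𝟙[ t ≤ x ] ≡ 1
𝟙[≤]≡1 z≤n       = refl
𝟙[≤]≡1 (s≤s t≤x) = 𝟙[≤]≡1 t≤x

𝟙[≰]≡0 : ∀ {t x} → ¬ t ≤ x → 𝟙[ t ≤ x ] ≡ 0
𝟙[≰]≡0 {zero}          t≰x = ⊥-elim (t≰x z≤n)
𝟙[≰]≡0 {suc t} {zero}  _   = refl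
𝟙[≰]≡0 {suc t} {suc x} t≰x = 𝟙[≰]≡0 (t≰x ∘ s≤s)

𝟙[≤]≤1 : ∀ t x → 𝟙[ t ≤ x ] ≤ 1
𝟙[≤]≤1 zero    x       = ≤-refl
𝟙[≤]≤1 (suc t) zero    = z≤n
𝟙[≤]≤1 (suc t) (suc x) = 𝟙[≤]≤1 t x

∑-𝟙[suc≤] : ∀ L x → ∑[ s < L ] 𝟙[ suc (toℕ s) ≤ x ] ≡ x ⊓ L
∑-𝟙[suc≤] zero    x       = sym (⊓-zeroʳ x)
∑-𝟙[suc≤] (suc L) zero    = sum-replicate-zero L
∑-𝟙[suc≤] (suc L) (suc x) = cong suc (∑-𝟙[suc≤] L x)

∑-suc : ∀ m (h : Fin m → ℕ) → ∑[ s < m ] suc (h s) ≡ m + ∑[ s < m ] h s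
∑-suc zero    h = refl
∑-suc (suc m) h =
  cong suc (trans (cong (h zero +_) (∑-suc m (h ∘ suc))) (x∙yz≈y∙xz (h zero) m _))

∑-shift : ∀ m (f g : ℕ → ℕ) →
          g 0 ≡ m → (∀ s → s < m → f s ≡ suc (g (suc s))) → f m ≡ 0 →
          ∑[ s < suc m ] f (toℕ s) ≡ ∑[ s < suc m ] g (toℕ s)
∑-shift m f g g0≡m f≡suc∘g fm≡0 = begin
    ∑[ s < suc m ] f (toℕ s)
  ≡⟨ sum-init-last (f ∘ toℕ) ⟩
    ∑[ s < m ] f (toℕ (inject₁ s)) + f (toℕ (fromℕ m))
  ≡⟨ cong (_+ f (toℕ (fromℕ m))) (sum-cong-≗ {m} (λ s → cong f (toℕ-inject₁ s))) ⟩
    ∑[ s < m ] f (toℕ s) + f (toℕ (fromℕ m))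
  ≡⟨ cong (∑[ s < m ] f (toℕ s) +_) (trans (cong f (toℕ-fromℕ m)) fm≡0) ⟩
    ∑[ s < m ] f (toℕ s) + 0
  ≡⟨ +-identityʳ _ ⟩
    ∑[ s < m ] f (toℕ s)
  ≡⟨ sum-cong-≗ {m} (λ s → f≡suc∘g (toℕ s) (toℕ<n s)) ⟩
    ∑[ s < m ] suc (g (suc (toℕ s)))
  ≡⟨ ∑-suc m (g ∘ suc ∘ toℕ) ⟩
    m + ∑[ s < m ] g (suc (toℕ s))
  ≡⟨ cong (_+ ∑[ s < m ] g (suc (toℕ s))) (sym g0≡m) ⟩
    ∑[ s < suc m ] g (toℕ s) ∎
  where open ≡-Reasoning

count≥ : ℕ → List ℕ → ℕ
count≥ t xs = List.sum (map 𝟙[ t ≤_] xs)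

count≥-↭ : ∀ t {xs ys} → xs ↭ ys → count≥ t xs ≡ count≥ t ys
count≥-↭ t xs↭ys = sum-↭ (map⁺ 𝟙[ t ≤_] xs↭ys)

count≥-all : ∀ {t xs} → All (t ≤_) xs → count≥ t xs ≡ length xs
count≥-all []           = refl
count≥-all (t≤x ∷ t≤xs) = cong₂ _+_ (𝟙[≤]≡1 t≤x) (count≥-all t≤xs)

-- The in-chips of ascending column heights xs whose first column meets the triangle in o cells.
cappedSum : ℕ → List ℕ → ℕ
cappedSum o []       = 0
cappedSum o (x ∷ xs) = x ⊓ o + cappedSum (suc o) xs

sum-zipWith-⊓≡cappedSum : ∀ o (f : ℕ → ℕ) xs → (∀ j → f j ≡ o + j) →
  List.sum (zipWith (λ j x → x ⊓ j) (applyUpTo f (length xs)) xs) ≡ cappedSum o xs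
sum-zipWith-⊓≡cappedSum o f []       _      = refl
sum-zipWith-⊓≡cappedSum o f (x ∷ xs) f≡o+_ =
  cong₂ _+_ (cong (x ⊓_) (trans (f≡o+_ 0) (+-identityʳ o)))
            (sum-zipWith-⊓≡cappedSum (suc o) (f ∘ suc) xs (λ j → trans (f≡o+_ (suc j)) (+-suc o j)))

count≥-∷-⊓ : ∀ t o {z xs} L → Linked _≤_ (z ∷ xs) → L ≡ o + suc (length xs) →
  count≥ t (z ∷ xs) ⊓ (L ∸ t) ≡ 𝟙[ t ≤ z ⊓ o ] + count≥ t xs ⊓ (L ∸ t)
count≥-∷-⊓ t o {z} {xs} _ sorted refl with t ≤? z
... | no t≰z
  rewrite 𝟙[≰]≡0 t≰z | 𝟙[≰]≡0 {t} {z ⊓ o} (t≰z ∘ λ t≤z⊓o → ≤-trans t≤z⊓o (m⊓n≤m z o)) = refl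
... | yes t≤z with Linked⇒All ≤-trans t≤z sorted
...   | _ ∷ t≤xs rewrite 𝟙[≤]≡1 t≤z | count≥-all t≤xs with t ≤? o
...     | yes t≤o rewrite 𝟙[≤]≡1 (⊓-glb t≤z t≤o) =
  trans (m≤n⇒m⊓n≡m long) (cong suc (sym (m≤n⇒m⊓n≡m (≤-trans (n≤1+n _) long))))
  where
  long : suc (length xs) ≤ o + suc (length xs) ∸ t
  long = subst (suc (length xs) ≤_) (sym (+-∸-comm (suc (length xs)) t≤o)) (m≤n+m _ _)
...     | no t≰o rewrite 𝟙[≰]≡0 {t} {z ⊓ o} (t≰o ∘ λ t≤z⊓o → ≤-trans t≤z⊓o (m⊓n≤n z o)) =
  trans (m≥n⇒m⊓n≡n (≤-trans short (n≤1+n _))) (sym (m≥n⇒m⊓n≡n short))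
  where
  short : o + suc (length xs) ∸ t ≤ length xs
  short = ≤-trans (∸-monoʳ-≤ (o + suc (length xs)) (≰⇒> t≰o))
                  (≤-reflexive (trans (cong (_∸ suc o) (+-suc o _)) (m+n∸m≡n o _)))

cappedSum-layers : ∀ o xs L → Linked _≤_ xs → L ≡ o + length xs →
  cappedSum o xs ≡ ∑[ s < L ] (count≥ (suc (toℕ s)) xs ⊓ (L ∸ suc (toℕ s)))
cappedSum-layers o []       L _      _ = sym (sum-replicate-zero L)
cappedSum-layers o (z ∷ xs) L sorted L≡o+len = begin
    z ⊓ o + cappedSum (suc o) xs
  ≡⟨ cong (z ⊓ o +_) (cappedSum-layers (suc o) xs L (tailₗ sorted) (trans L≡o+len (+-suc o _))) ⟩
    z ⊓ o + ∑[ s < L ] upper s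
  ≡⟨ cong (_+ ∑[ s < L ] upper s) (sym (trans (∑-𝟙[suc≤] L (z ⊓ o)) (m≤n⇒m⊓n≡m z⊓o≤L))) ⟩
    ∑[ s < L ] 𝟙[ suc (toℕ s) ≤ z ⊓ o ] + ∑[ s < L ] upper s
  ≡⟨ sym (∑-distrib-+ (λ s → 𝟙[ suc (toℕ s) ≤ z ⊓ o ]) upper) ⟩
    ∑[ s < L ] (𝟙[ suc (toℕ s) ≤ z ⊓ o ] + upper s)
  ≡⟨ sum-cong-≗ {L} (λ s → sym (count≥-∷-⊓ (suc (toℕ s)) o L sorted L≡o+len)) ⟩
    ∑[ s < L ] (count≥ (suc (toℕ s)) (z ∷ xs) ⊓ (L ∸ suc (toℕ s))) ∎
  where
  open ≡-Reasoning
  upper : Fin L → ℕ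
  upper s = count≥ (suc (toℕ s)) xs ⊓ (L ∸ suc (toℕ s))
  z⊓o≤L : z ⊓ o ≤ L
  z⊓o≤L = ≤-trans (m⊓n≤n z o) (subst (o ≤_) (sym L≡o+len) (m≤m+n o _))

rowLength : ∀ {n} → Config n → ℕ → ℕ
rowLength {n} d t = ∑[ w < n ] 𝟙[ t ≤ d w ]

rowLength-0 : ∀ {n} (d : Config n) → rowLength d 0 ≡ n
rowLength-0 {zero}  d = refl
rowLength-0 {suc n} d = cong suc (rowLength-0 (d ∘ suc))

count≥-toList : ∀ {n} (d : Config n) t → count≥ t (toList d) ≡ rowLength d t
count≥-toList {zero}  d t = refl
count≥-toList {suc n} d t = cong (𝟙[ t ≤ d zero ] +_) (count≥-toList (d ∘ suc) t)

inChipsByRows : ∀ {m} → Config (suc m) → ℕ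
inChipsByRows {m} d = ∑[ s < suc m ] (rowLength d (suc (toℕ s)) ⊓ (m ∸ toℕ s))

inChips≡inChipsByRows : ∀ {m} (d : Config (suc m)) → inChips d ≡ inChipsByRows d
inChips≡inChipsByRows {m} d = begin
    inChips d
  ≡⟨ cong (λ k → List.sum (zipWith (λ j x → x ⊓ j) (upTo k) sorted)) (sym length-sorted) ⟩
    List.sum (zipWith (λ j x → x ⊓ j) (applyUpTo id (length sorted)) sorted)
  ≡⟨ sum-zipWith-⊓≡cappedSum 0 id sorted (λ _ → refl) ⟩
    cappedSum 0 sorted
  ≡⟨ cappedSum-layers 0 sorted (suc m) (sort-↗ (toList d)) (sym length-sorted) ⟩
    ∑[ s < suc m ] (count≥ (suc (toℕ s)) sorted ⊓ (m ∸ toℕ s))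
  ≡⟨ sum-cong-≗ {suc m} (λ s → cong (_⊓ (m ∸ toℕ s)) (row (suc (toℕ s)))) ⟩
    inChipsByRows d ∎
  where
  open ≡-Reasoning
  sorted : List ℕ
  sorted = sort (toList d)
  length-sorted : length sorted ≡ suc m
  length-sorted = trans (↭-length (sort-↭ (toList d))) (length-tabulate d)
  row : ∀ t → count≥ t sorted ≡ rowLength d t
  row t = trans (count≥-↭ t (sort-↭ (toList d))) (count≥-toList d t)

fire-self : ∀ {n} (d : Config n) v → fire d v v ≡ d v ∸ deg n
fire-self d v with v ≟ v
... | yes _   = refl
... | no v≢v = ⊥-elim (v≢v refl)

fire-other : ∀ {n} (d : Config n) {v w} → v ≢ w → fire d v w ≡ suc (d w)
fire-other d {v} {w} v≢w with v ≟ w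
... | yes v≡w = ⊥-elim (v≢w v≡w)
... | no _    = refl

fire-≤-suc : ∀ {n} (d : Config n) v w → fire d v w ≤ suc (d w)
fire-≤-suc {n} d v w with v ≟ w
... | yes _ = ≤-trans (m∸n≤m (d w) (deg n)) (n≤1+n _)
... | no _  = ≤-refl

rowLength-fire : ∀ {n} (d : Config (suc n)) v t →
  rowLength (fire d v) (suc t) + 𝟙[ t ≤ d v ] ≡ rowLength d t + 𝟙[ suc t ≤ d v ∸ n ]
rowLength-fire {n} d v t = begin
    rowLength (fire d v) (suc t) + 𝟙[ t ≤ d v ]
  ≡⟨ cong (_+ 𝟙[ t ≤ d v ]) (sum-remove {i = v} (𝟙[ suc t ≤_] ∘ fire d v)) ⟩
    𝟙[ suc t ≤ fire d v v ] + sum (removeAt (𝟙[ suc t ≤_] ∘ fire d v) v) + 𝟙[ t ≤ d v ]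
  ≡⟨ cong (λ a → a + 𝟙[ t ≤ d v ]) (cong₂ _+_ (cong 𝟙[ suc t ≤_] (fire-self d v))
       (sum-cong-≗ {n} (λ j → cong 𝟙[ suc t ≤_] (fire-other d (punchInᵢ≢i v j ∘ sym))))) ⟩
    𝟙[ suc t ≤ d v ∸ n ] + sum (removeAt (𝟙[ t ≤_] ∘ d) v) + 𝟙[ t ≤ d v ]
  ≡⟨ xy∙z≈zy∙x 𝟙[ suc t ≤ d v ∸ n ] (sum (removeAt (𝟙[ t ≤_] ∘ d) v)) 𝟙[ t ≤ d v ] ⟩
    𝟙[ t ≤ d v ] + sum (removeAt (𝟙[ t ≤_] ∘ d) v) + 𝟙[ suc t ≤ d v ∸ n ]
  ≡⟨ cong (_+ 𝟙[ suc t ≤ d v ∸ n ]) (sum-remove {i = v} (𝟙[ t ≤_] ∘ d)) ⟨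
    rowLength d t + 𝟙[ suc t ≤ d v ∸ n ] ∎
  where open ≡-Reasoning

rowLength-≤-fire : ∀ {n} (d : Config (suc n)) v t →
  rowLength d t ≤ suc (rowLength (fire d v) (suc t))
rowLength-≤-fire {n} d v t = begin
    rowLength d t
  ≤⟨ m≤m+n _ _ ⟩
    rowLength d t + 𝟙[ suc t ≤ d v ∸ n ]
  ≡⟨ rowLength-fire d v t ⟨
    rowLength (fire d v) (suc t) + 𝟙[ t ≤ d v ]
  ≤⟨ +-monoʳ-≤ _ (𝟙[≤]≤1 t (d v)) ⟩
    rowLength (fire d v) (suc t) + 1
  ≡⟨ +-comm _ 1 ⟩
    suc (rowLength (fire d v) (suc t)) ∎
  where open ≤-Reasoning

rowLength-fire-first : ∀ {m} (d : Config (suc m)) v → m ≤ rowLength (fire d v) 1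
rowLength-fire-first d v = s≤s⁻¹ (subst (_≤ suc (rowLength (fire d v) 1)) (rowLength-0 d)
                                   (rowLength-≤-fire d v 0))

TallColumnsFillRows : ∀ {m} → Config (suc m) → Set
TallColumnsFillRows {m} d = ∀ t v → m + t < d v → suc m ∸ t ≤ rowLength d t

bounded⇒TallColumnsFillRows : ∀ {m} (d : Config (suc m)) → (∀ v → d v ≤ m) → TallColumnsFillRows d
bounded⇒TallColumnsFillRows {m} d bounded t v tall =
  ⊥-elim (<⇒≱ tall (≤-trans (bounded v) (m≤m+n m t)))

fire-TallColumnsFillRows : ∀ {m} (d : Config (suc m)) v →
  TallColumnsFillRows d → TallColumnsFillRows (fire d v)
fire-TallColumnsFillRows d v filled zero    w _    = ≤-reflexive (sym (rowLength-0 (fire d v)))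
fire-TallColumnsFillRows {m} d v filled (suc t) w tall = begin
    suc m ∸ suc t
  ≡⟨ pred[m∸n]≡m∸[1+n] (suc m) t ⟨
    pred (suc m ∸ t)
  ≤⟨ pred-mono-≤ (≤-trans (filled t w tall-before) (rowLength-≤-fire d v t)) ⟩
    rowLength (fire d v) (suc t) ∎
  where
  open ≤-Reasoning
  tall-before : m + t < d w
  tall-before = subst (_≤ d w) (+-suc m t) (s≤s⁻¹ (≤-trans tall (fire-≤-suc d v w)))

rowLength-fire-⊓ : ∀ {m} (d : Config (suc m)) v → m ≤ d v → TallColumnsFillRows d →
  ∀ s → s < m →
  rowLength d (suc s) ⊓ (m ∸ s) ≡ suc (rowLength (fire d v) (suc (suc s)) ⊓ (m ∸ suc s))
rowLength-fire-⊓ {m} d v canFire filled s s<m = begin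
    B ⊓ (m ∸ s)
  ≡⟨ cong (B ⊓_) m∸s≡1+K ⟩
    B ⊓ suc K
  ≡⟨ shifted (suc (suc s) ≤? d v ∸ m) ⟩
    suc (A ⊓ K) ∎
  where
  open ≡-Reasoning
  A B K : ℕ
  A = rowLength (fire d v) (suc (suc s))
  B = rowLength d (suc s)
  K = m ∸ suc s
  m∸s≡1+K : m ∸ s ≡ suc K
  m∸s≡1+K = +-∸-assoc 1 s<m
  A+1≡B+𝟙 : A + 1 ≡ B + 𝟙[ suc (suc s) ≤ d v ∸ m ]
  A+1≡B+𝟙 = trans (cong (A +_) (sym (𝟙[≤]≡1 (≤-trans s<m canFire)))) (rowLength-fire d v (suc s))
  shifted : Dec (suc (suc s) ≤ d v ∸ m) → B ⊓ suc K ≡ suc (A ⊓ K)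
  shifted (no short) = cong (_⊓ suc K) B≡1+A
    where
    B≡1+A : B ≡ suc A
    B≡1+A = begin
      B                                  ≡⟨ +-identityʳ B ⟨
      B + 0                              ≡⟨ cong (B +_) (𝟙[≰]≡0 short) ⟨
      B + 𝟙[ suc (suc s) ≤ d v ∸ m ]    ≡⟨ A+1≡B+𝟙 ⟨
      A + 1                              ≡⟨ +-comm A 1 ⟩
      suc A                              ∎
  shifted (yes tall) = trans (m≥n⇒m⊓n≡n full) (cong suc (sym (m≥n⇒m⊓n≡n K≤A)))
    where
    A≡B : A ≡ B
    A≡B = +-cancelʳ-≡ 1 A B (trans A+1≡B+𝟙 (cong (B +_) (𝟙[≤]≡1 tall)))
    tall-column : m + suc s < d v
    tall-column = subst₂ _≤_ (+-suc m (suc s)) (m+[n∸m]≡n canFire) (+-monoʳ-≤ m tall)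
    full : suc K ≤ B
    full = subst (_≤ B) m∸s≡1+K (filled (suc s) v tall-column)
    K≤A : K ≤ A
    K≤A = ≤-trans (n≤1+n K) (subst (suc K ≤_) (sym A≡B) full)

inChipsByRows-fire : ∀ {m} (d : Config (suc m)) v → CanFire d v → TallColumnsFillRows d →
  inChipsByRows (fire d v) ≡ inChipsByRows d
inChipsByRows-fire {m} d v canFire filled =
  sym (∑-shift m before after
         (m≥n⇒m⊓n≡n (rowLength-fire-first d v))
         (rowLength-fire-⊓ d v canFire filled)
         (trans (cong (rowLength d (suc m) ⊓_) (n∸n≡0 m)) (⊓-zeroʳ _)))
  where
  before after : ℕ → ℕ
  before s = rowLength d (suc s) ⊓ (m ∸ s)
  after  s = rowLength (fire d v) (suc s) ⊓ (m ∸ s)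

inChipsByRows-runList : ∀ {m} (d : Config (suc m)) vs → Legal d vs → TallColumnsFillRows d →
  inChipsByRows (runList d vs) ≡ inChipsByRows d
inChipsByRows-runList d []       _                  _      = refl
inChipsByRows-runList d (v ∷ vs) (canFire , legal) filled =
  trans (inChipsByRows-runList (fire d v) vs legal (fire-TallColumnsFillRows d v filled))
        (inChipsByRows-fire d v canFire filled)

lemma2p5 : (m : ℕ) (c : Config (suc m)) →
           (∀ (i j : Fin (suc m)) → i ≤ᶠ j → c j ≤ c i) →
           c zero ≡ m →
           (∀ (i : Fin m) → c (suc i) ≤ m ∸ 1) →
           ¬ Volatile c →
           (vs : List (Fin (suc m))) → Legal c vs → Stable (runList c vs) →
           inChips (runList c vs) ≡ inChips c
lemma2p5 m c nonincreasing c₀≡m _ _ vs legal _ = begin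
    inChips (runList c vs)
  ≡⟨ inChips≡inChipsByRows (runList c vs) ⟩
    inChipsByRows (runList c vs)
  ≡⟨ inChipsByRows-runList c vs legal (bounded⇒TallColumnsFillRows c bounded) ⟩
    inChipsByRows c
  ≡⟨ inChips≡inChipsByRows c ⟨
    inChips c ∎
  where
  open ≡-Reasoning
  bounded : ∀ v → c v ≤ m
  bounded v = subst (c v ≤_) c₀≡m (nonincreasing zero v z≤n)
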